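{- Let $p$ be an odd prime and $x_1,x_2\in\mathbb{F}_p$ with $x_2\ne0$. The set $\mathbb{F}_p\times\mathbb{F}_p$ with the operation $(a,b)\oplus(c,d)=(a+c,\ b+d+2ac)$ is a finite abelian group, and the map $\Phi:\mathfrak{N}\to(\mathbb{F}_p\times\mathbb{F}_p,\oplus)$, $t(1+\alpha t+\beta t^2+\cdots)\mapsto(\alpha,\beta)$, is a surjective group homomorphism. Furthermore: (i) $\mathfrak{N}(x_1,x_2)$ contains $\ker\Phi$ and is invariant under conjugation in $\mathfrak{N}$; (ii) $\mathfrak{N}=\bigcup_{k=0}^{p-1}\mathfrak{N}(x_1,x_2)\,g(k)$, a disjoint union, where $g(k)=t(1+kt^2)$.
   Context: $\mathfrak{N}$ is the Nottingham group over $\mathbb{F}_p$: the set $\{tz: z\in 1+t\mathbb{F}_p[[t]]\}$ under composition of power series (product $u\circ v$ means $u(v(t))$). For $\alpha\in\mathbb{F}_p$, $\binom{\alpha}{2}$ means $\binom{n}{2}\bmod p$ for any integer $n\equiv\alpha\pmod p$. Define $\mathfrak{N}(x_1,x_2)=\{u=t(1+\alpha t+\beta t^2+\cdots)\in\mathfrak{N}: \frac{x_1}{x_2}\alpha-\binom{\alpha}{2}+\beta\equiv0\pmod p\}$, and $\mathfrak{N}(x_1,x_2)g(k)=\{u\circ g(k): u\in\mathfrak{N}(x_1,x_2)\}$. -}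

module Defs where

open import Data.Nat using (ℕ; zero; suc; _+_; _*_; _∸_; _^_; NonZero)
open import Data.Nat.DivMod using (_mod_)
open import Data.Nat.Combinatorics using (_C_)
open import Data.Fin using (Fin; toℕ)
open import Data.Product using (_×_; _,_)
open import Relation.Binary.PropositionalEquality using (_≡_)

module Fp (p : ℕ) .{{_ : NonZero p}} where

  F : Set
  F = Fin p

  infixl 6 _+F_ _-F_
  infixl 7 _*F_

  _+F_ : F → F → F
  a +F b = (toℕ a + toℕ b) mod p

  _*F_ : F → F → F
  a *F b = (toℕ a * toℕ b) mod p

  -F_ : F → F
  -F a = (p ∸ toℕ a) mod p

  _-F_ : F → F → F
  a -F b = a +F (-F b)

  0F 1F 2F : F
  0F = 0 mod p
  1F = 1 mod p
  2F = 2 mod p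

  -- multiplicative inverse in 𝔽_p (p prime): a⁻¹ = a^(p-2)
  invF : F → F
  invF a = (toℕ a ^ (p ∸ 2)) mod p

  _/F_ : F → F → F
  x /F y = x *F invF y

  binom2 : F → F
  binom2 a = (toℕ a C 2) mod p

  _⊕_ : F × F → F × F → F × F
  (a , b) ⊕ (c , d) = (a +F c , b +F d +F 2F *F a *F c)

  -- formal power series over 𝔽_p: n ↦ coefficient of t^n
  Series : Set
  Series = ℕ → F

  _≈S_ : Series → Series → Set
  u ≈S v = ∀ n → u n ≡ v n

  sumTo : (ℕ → F) → ℕ → F
  sumTo f zero    = f 0
  sumTo f (suc n) = sumTo f n +F f (suc n)

  pow : Series → ℕ → Series
  pow v zero zero    = 1F
  pow v zero (suc n) = 0F
  pow v (suc k) n    = sumTo (λ i → v i *F pow v k (n ∸ i)) n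

  -- composition u ∘ v = u(v(t)) = Σ_k u_k v^k ; valid when v has zero
  -- constant term (the terms with k > n do not contribute to t^n)
  _∘S_ : Series → Series → Series
  (u ∘S v) n = sumTo (λ k → u k *F pow v k n) n

  tS : Series
  tS 1 = 1F
  tS _ = 0F

  -- membership in the Nottingham group: u = t(1 + a₁t + a₂t² + ⋯)
  InN : Series → Set
  InN u = (u 0 ≡ 0F) × (u 1 ≡ 1F)

  -- Φ(t(1 + αt + βt² + ⋯)) = (α, β)
  Φ : Series → F × F
  Φ u = (u 2 , u 3)

  InN12 : F → F → Series → Set
  InN12 x₁ x₂ u =
    InN u × ((x₁ /F x₂) *F u 2 -F binom2 (u 2) +F u 3 ≡ 0F)

  g : F → Series
  g k 1 = 1F
  g k 3 = k
  g k _ = 0F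

module Submission where

-- 1. 𝔽_p = Fin p is a commutative ring: reduction mod p, n ↦ [ n ], is a
--    surjective semiring homomorphism ℕ → Fin p, so every ring law is
--    transported from ℕ.  The ring solver is then available on 𝔽_p.
-- 2. (𝔽_p × 𝔽_p, ⊕) is an abelian group; each law is a ring identity.
-- 3. For v ∈ 𝔑 the power vᵏ starts with tᵏ, which yields the coefficients of
--    u ∘ v in degrees ≤ 3; in particular Φ(u ∘ v) = Φ u ⊕ Φ v.  The same
--    triangularity lets one solve v ∘ G = u for v, degree by degree.
-- 4. 𝔑(x₁,x₂) is the Φ-preimage of the zero set of the defect
--    (a, b) ↦ (x₁/x₂)a − binom(a,2) + b, and Φ(g k) = (0, k) shifts the defect
--    by k.  Hence u lies in the coset of k = defect(Φ u), and only in that one.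

open import Defs
open import Level using (0ℓ)
open import Function using (_∘_)
open import Relation.Nullary using (yes; no)
open import Data.Empty using (⊥-elim)
open import Data.Nat.Primality using (Prime)
open import Data.Nat as ℕ using (ℕ; zero; suc; NonZero; _%_; z≤n; s≤s)
import Data.Nat.Properties as ℕₚ
open import Data.Nat.Combinatorics using (_C_)
open import Data.Nat.DivMod using (_mod_; %-distribˡ-+; %-distribˡ-*; m<n⇒m%n≡m; n%n≡0; m*n%n≡0)
open import Data.Fin using (toℕ)
open import Data.Fin.Properties using (toℕ-injective; toℕ-fromℕ<; toℕ<n)
open import Data.Product using (_×_; _,_; ∃-syntax; proj₁; proj₂)
open import Relation.Binary.PropositionalEquality
  using (_≡_; _≢_; refl; sym; trans; cong; cong₂; isEquivalence; module ≡-Reasoning)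
open import Algebra.Structures using (IsCommutativeRing; IsAbelianGroup)
open import Algebra.Bundles using (CommutativeRing; AbelianGroup)

module Proof (p : ℕ) .{{_ : NonZero p}} where
  open Fp p
  open ≡-Reasoning

  [_] : ℕ → F
  [ n ] = n mod p

  toℕ-[] : ∀ n → toℕ [ n ] ≡ n % p
  toℕ-[] n = toℕ-fromℕ< _

  [toℕ] : ∀ a → [ toℕ a ] ≡ a
  [toℕ] a = toℕ-injective (trans (toℕ-[] (toℕ a)) (m<n⇒m%n≡m (toℕ<n a)))

  []-+ : ∀ m n → [ m ] +F [ n ] ≡ [ m ℕ.+ n ]
  []-+ m n = toℕ-injective (begin
    toℕ ([ m ] +F [ n ])              ≡⟨ toℕ-[] _ ⟩
    (toℕ [ m ] ℕ.+ toℕ [ n ]) % p    ≡⟨ cong₂ (λ x y → (x ℕ.+ y) % p) (toℕ-[] m) (toℕ-[] n) ⟩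
    (m % p ℕ.+ n % p) % p            ≡⟨ sym (%-distribˡ-+ m n p) ⟩
    (m ℕ.+ n) % p                    ≡⟨ sym (toℕ-[] _) ⟩
    toℕ [ m ℕ.+ n ]                  ∎)

  []-* : ∀ m n → [ m ] *F [ n ] ≡ [ m ℕ.* n ]
  []-* m n = toℕ-injective (begin
    toℕ ([ m ] *F [ n ])              ≡⟨ toℕ-[] _ ⟩
    (toℕ [ m ] ℕ.* toℕ [ n ]) % p    ≡⟨ cong₂ (λ x y → (x ℕ.* y) % p) (toℕ-[] m) (toℕ-[] n) ⟩
    (m % p ℕ.* (n % p)) % p          ≡⟨ sym (%-distribˡ-* m n p) ⟩
    (m ℕ.* n) % p                    ≡⟨ sym (toℕ-[] _) ⟩
    toℕ [ m ℕ.* n ]                  ∎)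

  toℕ-0F : toℕ 0F ≡ 0
  toℕ-0F = trans (toℕ-[] 0) (m*n%n≡0 0 p)

  [p]≡0F : [ p ] ≡ 0F
  [p]≡0F = toℕ-injective (trans (toℕ-[] p) (trans (n%n≡0 p) (sym toℕ-0F)))

  []-+ʳ : ∀ n a → [ n ] +F a ≡ [ n ℕ.+ toℕ a ]
  []-+ʳ n a = trans (cong ([ n ] +F_) (sym ([toℕ] a))) ([]-+ n (toℕ a))

  []-*ʳ : ∀ n a → [ n ] *F a ≡ [ n ℕ.* toℕ a ]
  []-*ʳ n a = trans (cong ([ n ] *F_) (sym ([toℕ] a))) ([]-* n (toℕ a))

  +F-assoc : ∀ a b c → (a +F b) +F c ≡ a +F (b +F c)
  +F-assoc a b c = begin
    [ toℕ a ℕ.+ toℕ b ] +F c          ≡⟨ []-+ʳ _ c ⟩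
    [ toℕ a ℕ.+ toℕ b ℕ.+ toℕ c ]     ≡⟨ cong [_] (ℕₚ.+-assoc (toℕ a) (toℕ b) (toℕ c)) ⟩
    [ toℕ a ℕ.+ (toℕ b ℕ.+ toℕ c) ]   ≡⟨ sym ([]-+ _ _) ⟩
    [ toℕ a ] +F [ toℕ b ℕ.+ toℕ c ]  ≡⟨ cong (_+F (b +F c)) ([toℕ] a) ⟩
    a +F (b +F c)                     ∎

  *F-assoc : ∀ a b c → (a *F b) *F c ≡ a *F (b *F c)
  *F-assoc a b c = begin
    [ toℕ a ℕ.* toℕ b ] *F c          ≡⟨ []-*ʳ _ c ⟩
    [ toℕ a ℕ.* toℕ b ℕ.* toℕ c ]     ≡⟨ cong [_] (ℕₚ.*-assoc (toℕ a) (toℕ b) (toℕ c)) ⟩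
    [ toℕ a ℕ.* (toℕ b ℕ.* toℕ c) ]   ≡⟨ sym ([]-* _ _) ⟩
    [ toℕ a ] *F [ toℕ b ℕ.* toℕ c ]  ≡⟨ cong (_*F (b *F c)) ([toℕ] a) ⟩
    a *F (b *F c)                     ∎

  +F-comm : ∀ a b → a +F b ≡ b +F a
  +F-comm a b = cong [_] (ℕₚ.+-comm (toℕ a) (toℕ b))

  *F-comm : ∀ a b → a *F b ≡ b *F a
  *F-comm a b = cong [_] (ℕₚ.*-comm (toℕ a) (toℕ b))

  +F-identityˡ : ∀ a → 0F +F a ≡ a
  +F-identityˡ a = trans ([]-+ʳ 0 a) ([toℕ] a)

  *F-identityˡ : ∀ a → 1F *F a ≡ a
  *F-identityˡ a = trans ([]-*ʳ 1 a) (trans (cong [_] (ℕₚ.*-identityˡ (toℕ a))) ([toℕ] a))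

  -F-inverseˡ : ∀ a → (-F a) +F a ≡ 0F
  -F-inverseˡ a = begin
    [ p ℕ.∸ toℕ a ] +F a          ≡⟨ []-+ʳ _ a ⟩
    [ p ℕ.∸ toℕ a ℕ.+ toℕ a ]     ≡⟨ cong [_] (ℕₚ.m∸n+n≡m (ℕₚ.<⇒≤ (toℕ<n a))) ⟩
    [ p ]                         ≡⟨ [p]≡0F ⟩
    0F                            ∎

  *F-distribʳ : ∀ a b c → (b +F c) *F a ≡ (b *F a) +F (c *F a)
  *F-distribʳ a b c = begin
    [ toℕ b ℕ.+ toℕ c ] *F a                  ≡⟨ []-*ʳ _ a ⟩
    [ (toℕ b ℕ.+ toℕ c) ℕ.* toℕ a ]           ≡⟨ cong [_] (ℕₚ.*-distribʳ-+ (toℕ a) (toℕ b) (toℕ c)) ⟩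
    [ toℕ b ℕ.* toℕ a ℕ.+ toℕ c ℕ.* toℕ a ]   ≡⟨ sym ([]-+ _ _) ⟩
    (b *F a) +F (c *F a)                      ∎

  isCommutativeRing : IsCommutativeRing _≡_ _+F_ _*F_ -F_ 0F 1F
  isCommutativeRing = record
    { isRing = record
      { +-isAbelianGroup = record
        { isGroup = record
          { isMonoid = record
            { isSemigroup = record
              { isMagma = record { isEquivalence = isEquivalence ; ∙-cong = cong₂ _+F_ }
              ; assoc = +F-assoc }
            ; identity = +F-identityˡ , λ a → trans (+F-comm a 0F) (+F-identityˡ a) }
          ; inverse = -F-inverseˡ , λ a → trans (+F-comm a (-F a)) (-F-inverseˡ a)
          ; ⁻¹-cong = cong (λ a → -F a) }
        ; comm = +F-comm }
      ; *-cong = cong₂ _*F_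
      ; *-assoc = *F-assoc
      ; *-identity = *F-identityˡ , λ a → trans (*F-comm a 1F) (*F-identityˡ a)
      ; distrib = (λ a b c → trans (*F-comm a (b +F c))
                              (trans (*F-distribʳ a b c) (cong₂ _+F_ (*F-comm b a) (*F-comm c a))))
                , *F-distribʳ }
    ; *-comm = *F-comm }

  𝔽 : CommutativeRing 0ℓ 0ℓ
  𝔽 = record { isCommutativeRing = isCommutativeRing }

  open import Algebra.Solver.Ring.NaturalCoefficients.Default (CommutativeRing.commutativeSemiring 𝔽)

  open CommutativeRing 𝔽 using (+-group; -‿inverseˡ; -‿inverseʳ; +-identityʳ; *-identityʳ; zeroˡ; zeroʳ)
  open import Algebra.Properties.Group +-group using (ε⁻¹≈ε; identityˡ-unique)

  ⊕-zero : F × F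
  ⊕-zero = (0F , 0F)

  ⊕-inverse : F × F → F × F
  ⊕-inverse (a , b) = (-F a , (-F b) +F 2F *F a *F a)

  ⊕-assoc : ∀ x y z → (x ⊕ y) ⊕ z ≡ x ⊕ (y ⊕ z)
  ⊕-assoc (a , b) (c , d) (e , f) = cong₂ _,_ (+F-assoc a c e)
    (solve 7 (λ a b c d e f t → b :+ d :+ t :* a :* c :+ f :+ t :* (a :+ c) :* e
                              := b :+ (d :+ f :+ t :* c :* e) :+ t :* a :* (c :+ e))
           refl a b c d e f 2F)

  ⊕-comm : ∀ x y → x ⊕ y ≡ y ⊕ x
  ⊕-comm (a , b) (c , d) = cong₂ _,_ (+F-comm a c)
    (solve 5 (λ a b c d t → b :+ d :+ t :* a :* c := d :+ b :+ t :* c :* a) refl a b c d 2F)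

  ⊕-identityˡ : ∀ x → ⊕-zero ⊕ x ≡ x
  ⊕-identityˡ (a , b) = cong₂ _,_ (+F-identityˡ a)
    (solve 3 (λ a b t → con 0 :+ b :+ t :* con 0 :* a := b) refl a b 2F)

  ⊕-inverseˡ : ∀ x → ⊕-inverse x ⊕ x ≡ ⊕-zero
  ⊕-inverseˡ (a , b) = cong₂ _,_ (-‿inverseˡ a) (begin
    (-F b) +F 2F *F a *F a +F b +F 2F *F (-F a) *F a
      ≡⟨ solve 5 (λ a b -a -b t → -b :+ t :* a :* a :+ b :+ t :* -a :* a
                                  := (-b :+ b) :+ t :* a :* (a :+ -a)) refl a b (-F a) (-F b) 2F ⟩
    ((-F b) +F b) +F 2F *F a *F (a +F (-F a))
      ≡⟨ cong₂ (λ x y → x +F 2F *F a *F y) (-‿inverseˡ b) (-‿inverseʳ a) ⟩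
    0F +F 2F *F a *F 0F
      ≡⟨ solve 2 (λ a t → con 0 :+ t :* a :* con 0 := con 0) refl a 2F ⟩
    0F ∎)

  ⊕-isAbelianGroup : IsAbelianGroup _≡_ _⊕_ ⊕-zero ⊕-inverse
  ⊕-isAbelianGroup = record
    { isGroup = record
      { isMonoid = record
        { isSemigroup = record
          { isMagma = record { isEquivalence = isEquivalence ; ∙-cong = cong₂ _⊕_ }
          ; assoc = ⊕-assoc }
        ; identity = ⊕-identityˡ , λ x → trans (⊕-comm x ⊕-zero) (⊕-identityˡ x) }
      ; inverse = ⊕-inverseˡ , λ x → trans (⊕-comm x (⊕-inverse x)) (⊕-inverseˡ x)
      ; ⁻¹-cong = cong ⊕-inverse }
    ; comm = ⊕-comm }

  ⊕-group : AbelianGroup 0ℓ 0ℓ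
  ⊕-group = record { isAbelianGroup = ⊕-isAbelianGroup }

  open import Algebra.Properties.CommutativeSemigroup (AbelianGroup.commutativeSemigroup ⊕-group)
    using (xy∙z≈y∙xz)

  sumTo-cong : ∀ {f f'} n → (∀ i → i ℕ.≤ n → f i ≡ f' i) → sumTo f n ≡ sumTo f' n
  sumTo-cong zero    eq = eq 0 z≤n
  sumTo-cong (suc n) eq =
    cong₂ _+F_ (sumTo-cong n (λ i i≤n → eq i (ℕₚ.m≤n⇒m≤1+n i≤n))) (eq (suc n) ℕₚ.≤-refl)

  sumTo-zero : ∀ {f} n → (∀ i → i ℕ.≤ n → f i ≡ 0F) → sumTo f n ≡ 0F
  sumTo-zero zero    vanish = vanish 0 z≤n
  sumTo-zero (suc n) vanish = trans
    (cong₂ _+F_ (sumTo-zero n (λ i i≤n → vanish i (ℕₚ.m≤n⇒m≤1+n i≤n))) (vanish (suc n) ℕₚ.≤-refl))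
    (+-identityʳ 0F)

  sumTo-single : ∀ {f} n j → j ℕ.≤ n → (∀ i → i ℕ.≤ n → i ≢ j → f i ≡ 0F) → sumTo f n ≡ f j
  sumTo-single zero    .zero z≤n _ = refl
  sumTo-single {f} (suc n) j j≤1+n vanish with j ℕ.≟ suc n
  ... | yes refl = trans
    (cong (_+F f (suc n)) (sumTo-zero n (λ i i≤n → vanish i (ℕₚ.m≤n⇒m≤1+n i≤n) (ℕₚ.<⇒≢ (s≤s i≤n)))))
    (+F-identityˡ (f (suc n)))
  ... | no j≢1+n = trans
    (cong₂ _+F_ (sumTo-single n j (ℕₚ.m<1+n⇒m≤n (ℕₚ.≤∧≢⇒< j≤1+n j≢1+n))
                                  (λ i i≤n → vanish i (ℕₚ.m≤n⇒m≤1+n i≤n)))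
                (vanish (suc n) ℕₚ.≤-refl (j≢1+n ∘ sym)))
    (+-identityʳ (f j))

  pow-below : ∀ v → InN v → ∀ n m → m ℕ.< n → pow v n m ≡ 0F
  pow-below v hv@(v0 , _) (suc n) m m<1+n = sumTo-zero m term
    where
    term : ∀ i → i ℕ.≤ m → v i *F pow v n (m ℕ.∸ i) ≡ 0F
    term zero    _   = trans (cong (_*F pow v n m) v0) (zeroˡ _)
    term (suc i) 1+i≤m = trans
      (cong (v (suc i) *F_) (pow-below v hv n (m ℕ.∸ suc i)
         (ℕₚ.<-≤-trans (ℕₚ.∸-monoʳ-< (s≤s z≤n) 1+i≤m) (ℕₚ.m<1+n⇒m≤n m<1+n))))
      (zeroʳ (v (suc i)))

  pow-diag : ∀ v → InN v → ∀ n → pow v n n ≡ 1F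
  pow-diag v hv@(v0 , v1) zero    = refl
  pow-diag v hv@(v0 , v1) (suc n) = begin
    pow v (suc n) (suc n)  ≡⟨ sumTo-single (suc n) 1 (s≤s z≤n) term ⟩
    v 1 *F pow v n n       ≡⟨ cong₂ _*F_ v1 (pow-diag v hv n) ⟩
    1F *F 1F               ≡⟨ *F-identityˡ 1F ⟩
    1F                     ∎
    where
    term : ∀ i → i ℕ.≤ suc n → i ≢ 1 → v i *F pow v n (suc n ℕ.∸ i) ≡ 0F
    term zero          _           _   = trans (cong (_*F pow v n (suc n)) v0) (zeroˡ _)
    term (suc zero)    _           i≢1 = ⊥-elim (i≢1 refl)
    term (suc (suc i)) (s≤s 1+i≤n) _   = trans
      (cong (v (suc (suc i)) *F_) (pow-below v hv n (n ℕ.∸ suc i) (ℕₚ.∸-monoʳ-< (s≤s z≤n) 1+i≤n)))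
      (zeroʳ (v (suc (suc i))))

  pow-one : ∀ v n → pow v 1 n ≡ v n
  pow-one v n = begin
    pow v 1 n                   ≡⟨ sumTo-single n n ℕₚ.≤-refl term ⟩
    v n *F pow v 0 (n ℕ.∸ n)    ≡⟨ cong (λ m → v n *F pow v 0 m) (ℕₚ.n∸n≡0 n) ⟩
    v n *F 1F                   ≡⟨ *-identityʳ (v n) ⟩
    v n                         ∎
    where
    pow-zero-pos : ∀ m → 0 ℕ.< m → pow v 0 m ≡ 0F
    pow-zero-pos (suc m) _ = refl
    term : ∀ i → i ℕ.≤ n → i ≢ n → v i *F pow v 0 (n ℕ.∸ i) ≡ 0F
    term i i≤n i≢n = trans
      (cong (v i *F_) (pow-zero-pos (n ℕ.∸ i) (ℕₚ.m<n⇒0<n∸m (ℕₚ.≤∧≢⇒< i≤n i≢n))))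
      (zeroʳ (v i))

  pow-two-3 : ∀ v → InN v → pow v 2 3 ≡ 2F *F v 2
  pow-two-3 v (v0 , v1) = begin
    v 0 *F pow v 1 3 +F v 1 *F pow v 1 2 +F v 2 *F pow v 1 1 +F v 3 *F pow v 1 0
      ≡⟨ cong₂ _+F_ (cong₂ _+F_ (cong₂ _+F_ (cong₂ _*F_ v0 (pow-one v 3)) (cong₂ _*F_ v1 (pow-one v 2)))
                                (cong (v 2 *F_) (trans (pow-one v 1) v1)))
                    (cong (v 3 *F_) (trans (pow-one v 0) v0)) ⟩
    0F *F v 3 +F 1F *F v 2 +F v 2 *F 1F +F v 3 *F 0F
      ≡⟨ solve 2 (λ a b → con 0 :* b :+ con 1 :* a :+ a :* con 1 :+ b :* con 0 := (con 1 :+ con 1) :* a)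
               refl (v 2) (v 3) ⟩
    (1F +F 1F) *F v 2
      ≡⟨ cong (_*F v 2) ([]-+ 1 1) ⟩
    2F *F v 2 ∎

  ∘S-coeff₀ : ∀ u v → (u ∘S v) 0 ≡ u 0
  ∘S-coeff₀ u v = *-identityʳ (u 0)

  ∘S-coeff₁ : ∀ u v → InN v → (u ∘S v) 1 ≡ u 1
  ∘S-coeff₁ u v (_ , v1) = begin
    u 0 *F 0F +F u 1 *F pow v 1 1  ≡⟨ cong₂ _+F_ (zeroʳ (u 0)) (cong (u 1 *F_) (trans (pow-one v 1) v1)) ⟩
    0F +F u 1 *F 1F                ≡⟨ solve 1 (λ a → con 0 :+ a :* con 1 := a) refl (u 1) ⟩
    u 1                            ∎

  ∘S-coeff₂ : ∀ u v → InN u → InN v → (u ∘S v) 2 ≡ u 2 +F v 2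
  ∘S-coeff₂ u v (u0 , u1) hv = begin
    u 0 *F 0F +F u 1 *F pow v 1 2 +F u 2 *F pow v 2 2
      ≡⟨ cong₂ _+F_ (cong₂ _+F_ (cong (_*F 0F) u0) (cong₂ _*F_ u1 (pow-one v 2))) (cong (u 2 *F_) (pow-diag v hv 2)) ⟩
    0F *F 0F +F 1F *F v 2 +F u 2 *F 1F
      ≡⟨ solve 2 (λ a b → con 0 :* con 0 :+ con 1 :* b :+ a :* con 1 := a :+ b) refl (u 2) (v 2) ⟩
    u 2 +F v 2 ∎

  ∘S-coeff₃ : ∀ u v → InN u → InN v → (u ∘S v) 3 ≡ u 3 +F v 3 +F 2F *F u 2 *F v 2
  ∘S-coeff₃ u v (u0 , u1) hv = begin
    u 0 *F 0F +F u 1 *F pow v 1 3 +F u 2 *F pow v 2 3 +F u 3 *F pow v 3 3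
      ≡⟨ cong₂ _+F_ (cong₂ _+F_ (cong₂ _+F_ (cong (_*F 0F) u0) (cong₂ _*F_ u1 (pow-one v 3)))
                                (cong (u 2 *F_) (pow-two-3 v hv)))
                    (cong (u 3 *F_) (pow-diag v hv 3)) ⟩
    0F *F 0F +F 1F *F v 3 +F u 2 *F (2F *F v 2) +F u 3 *F 1F
      ≡⟨ solve 5 (λ a₂ a₃ b₂ b₃ t → con 0 :* con 0 :+ con 1 :* b₃ :+ a₂ :* (t :* b₂) :+ a₃ :* con 1
                                  := a₃ :+ b₃ :+ t :* a₂ :* b₂) refl (u 2) (u 3) (v 2) (v 3) 2F ⟩
    u 3 +F v 3 +F 2F *F u 2 *F v 2 ∎

  ∘S-InN : ∀ u v → InN u → InN v → InN (u ∘S v)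
  ∘S-InN u v (u0 , u1) hv = trans (∘S-coeff₀ u v) u0 , trans (∘S-coeff₁ u v hv) u1

  Φ-hom : ∀ u v → InN u → InN v → Φ (u ∘S v) ≡ Φ u ⊕ Φ v
  Φ-hom u v hu hv = cong₂ _,_ (∘S-coeff₂ u v hu hv) (∘S-coeff₃ u v hu hv)

  Φ-cong : ∀ {u v} → u ≈S v → Φ u ≡ Φ v
  Φ-cong u≈v = cong₂ _,_ (u≈v 2) (u≈v 3)

  cubic : F → F → Series
  cubic a b 1 = 1F
  cubic a b 2 = a
  cubic a b 3 = b
  cubic a b _ = 0F

  Φ-surjective : ∀ (ab : F × F) → ∃[ u ] (InN u × Φ u ≡ ab)
  Φ-surjective (a , b) = cubic a b , (refl , refl) , refl

  -- Since Gᵏ = tᵏ + (higher terms), the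
  -- equation (v ∘ G)ₙ = uₙ reads vₙ = uₙ − Σ_{k<n} vₖ (Gᵏ)ₙ, which determines v
  -- degree by degree.  `approx n` holds the correct coefficients in degrees ≤ n.
  module RightDivision (G : Series) (hG : InN G) (u : Series) where

    approx : ℕ → Series
    approx zero    _ = u 0
    approx (suc n) j with j ℕ.≤? n
    ... | yes _ = approx n j
    ... | no  _ = u (suc n) -F sumTo (λ i → approx n i *F pow G i (suc n)) n

    approx-new : ∀ n → approx (suc n) (suc n) ≡ u (suc n) -F sumTo (λ i → approx n i *F pow G i (suc n)) n
    approx-new n with suc n ℕ.≤? n
    ... | yes 1+n≤n = ⊥-elim (ℕₚ.n≮n n 1+n≤n)
    ... | no  _     = refl

    approx-stable : ∀ d n j → j ℕ.≤ n → approx (d ℕ.+ n) j ≡ approx n j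
    approx-stable zero    n j j≤n = refl
    approx-stable (suc d) n j j≤n with j ℕ.≤? d ℕ.+ n
    ... | yes _   = approx-stable d n j j≤n
    ... | no  j≰ = ⊥-elim (j≰ (ℕₚ.≤-trans j≤n (ℕₚ.m≤n+m n d)))

    quotient : Series
    quotient j = approx j j

    quotient-approx : ∀ n j → j ℕ.≤ n → quotient j ≡ approx n j
    quotient-approx n j j≤n = trans (sym (approx-stable (n ℕ.∸ j) j j ℕₚ.≤-refl))
                                    (cong (λ m → approx m j) (ℕₚ.m∸n+n≡m j≤n))

    quotient-spec : (quotient ∘S G) ≈S u
    quotient-spec zero    = *-identityʳ (u 0)
    quotient-spec (suc n) = begin
      S′ +F quotient (suc n) *F pow G (suc n) (suc n)
        ≡⟨ cong₂ (λ x y → x +F y *F pow G (suc n) (suc n)) lower (approx-new n) ⟩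
      S +F (u (suc n) -F S) *F pow G (suc n) (suc n)
        ≡⟨ cong (λ z → S +F (u (suc n) -F S) *F z) (pow-diag G hG (suc n)) ⟩
      S +F (u (suc n) -F S) *F 1F
        ≡⟨ solve 3 (λ s a -s → s :+ (a :+ -s) :* con 1 := a :+ (s :+ -s)) refl S (u (suc n)) (-F S) ⟩
      u (suc n) +F (S -F S)
        ≡⟨ cong (u (suc n) +F_) (-‿inverseʳ S) ⟩
      u (suc n) +F 0F
        ≡⟨ +-identityʳ (u (suc n)) ⟩
      u (suc n) ∎
      where
      S S′ : F
      S  = sumTo (λ i → approx n i *F pow G i (suc n)) n
      S′ = sumTo (λ i → quotient i *F pow G i (suc n)) n
      lower : S′ ≡ S
      lower = sumTo-cong n (λ i i≤n → cong (_*F pow G i (suc n)) (quotient-approx n i i≤n))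

  right-division : ∀ G → InN G → ∀ u → ∃[ v ] (v ∘S G) ≈S u
  right-division G hG u = quotient , quotient-spec
    where open RightDivision G hG u

  quotient-InN : ∀ G u v → InN G → InN u → (v ∘S G) ≈S u → InN v
  quotient-InN G u v hG (u0 , u1) v∘G≈u =
    trans (sym (∘S-coeff₀ v G)) (trans (v∘G≈u 0) u0) ,
    trans (sym (∘S-coeff₁ v G hG)) (trans (v∘G≈u 1) u1)

  -- Composing with g(k), whose image is
  -- (0, k), shifts the defect by k; this gives both halves of (ii).
  module Cosets (x₁ x₂ : F) where

    defect : F × F → F
    defect (a , b) = (x₁ /F x₂) *F a -F binom2 a +F b

    defect-zero : defect ⊕-zero ≡ 0F
    defect-zero = begin
      (x₁ /F x₂) *F 0F -F binom2 0F +F 0F  ≡⟨ cong (λ m → (x₁ /F x₂) *F 0F -F [ m C 2 ] +F 0F) toℕ-0F ⟩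
      (x₁ /F x₂) *F 0F -F 0F +F 0F         ≡⟨ cong (λ z → (x₁ /F x₂) *F 0F +F z +F 0F) ε⁻¹≈ε ⟩
      (x₁ /F x₂) *F 0F +F 0F +F 0F         ≡⟨ solve 1 (λ c → c :* con 0 :+ con 0 :+ con 0 := con 0) refl (x₁ /F x₂) ⟩
      0F                                   ∎

    defect-shift : ∀ x k → defect (x ⊕ (0F , k)) ≡ defect x +F k
    defect-shift (a , b) k = begin
      defect (a +F 0F , b +F k +F 2F *F a *F 0F)
        ≡⟨ cong₂ (λ x y → defect (x , y)) (+-identityʳ a)
                 (solve 4 (λ a b k t → b :+ k :+ t :* a :* con 0 := b :+ k) refl a b k 2F) ⟩
      defect (a , b +F k)
        ≡⟨ sym (+F-assoc _ b k) ⟩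
      defect (a , b) +F k ∎

    defect-coset : ∀ v k → InN v → defect (Φ (v ∘S g k)) ≡ defect (Φ v) +F k
    defect-coset v k hv = trans (cong defect (Φ-hom v (g k) hv (refl , refl))) (defect-shift (Φ v) k)

    kernel⊆ : ∀ u → InN u → Φ u ≡ ⊕-zero → InN12 x₁ x₂ u
    kernel⊆ u hu Φu≡0 = hu , trans (cong defect Φu≡0) defect-zero

    -- (i) conjugation does not change Φ, since the target group is abelian
    conjugation-invariant : ∀ w w′ u → InN w → InN w′ → (w ∘S w′) ≈S tS → (w′ ∘S w) ≈S tS →
                            InN12 x₁ x₂ u → InN12 x₁ x₂ ((w ∘S u) ∘S w′)
    conjugation-invariant w w′ u hw hw′ ww′≈t _ (hu , defect≡0) =
      ∘S-InN (w ∘S u) w′ (∘S-InN w u hw hu) hw′ , trans (cong defect Φ-conj) defect≡0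
      where
      Φ-conj : Φ ((w ∘S u) ∘S w′) ≡ Φ u
      Φ-conj = begin
        Φ ((w ∘S u) ∘S w′)   ≡⟨ Φ-hom (w ∘S u) w′ (∘S-InN w u hw hu) hw′ ⟩
        Φ (w ∘S u) ⊕ Φ w′    ≡⟨ cong (_⊕ Φ w′) (Φ-hom w u hw hu) ⟩
        (Φ w ⊕ Φ u) ⊕ Φ w′   ≡⟨ xy∙z≈y∙xz (Φ w) (Φ u) (Φ w′) ⟩
        Φ u ⊕ (Φ w ⊕ Φ w′)   ≡⟨ cong (Φ u ⊕_) (trans (sym (Φ-hom w w′ hw hw′)) (Φ-cong ww′≈t)) ⟩
        Φ u ⊕ ⊕-zero         ≡⟨ trans (⊕-comm (Φ u) ⊕-zero) (⊕-identityˡ (Φ u)) ⟩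
        Φ u                  ∎

    -- (ii) every u ∈ 𝔑 lies in the coset 𝔑(x₁,x₂) g(k) with k the defect of Φ u
    coset-cover : ∀ u → InN u → ∃[ k ] ∃[ v ] (InN12 x₁ x₂ v × (v ∘S g k) ≈S u)
    coset-cover u hu = k , v , (hv , defect-v≡0) , v∘g≈u
      where
      k : F
      k = defect (Φ u)
      v : Series
      v = proj₁ (right-division (g k) (refl , refl) u)
      v∘g≈u : (v ∘S g k) ≈S u
      v∘g≈u = proj₂ (right-division (g k) (refl , refl) u)
      hv : InN v
      hv = quotient-InN (g k) u v (refl , refl) hu v∘g≈u
      defect-v≡0 : defect (Φ v) ≡ 0F
      defect-v≡0 = identityˡ-unique (defect (Φ v)) k
        (trans (sym (defect-coset v k hv)) (cong defect (Φ-cong v∘g≈u)))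

    -- (ii) the cosets are disjoint: the defect of v ∘ g(k) recovers k
    coset-disjoint : ∀ k k′ v v′ → InN12 x₁ x₂ v → InN12 x₁ x₂ v′ →
                     (v ∘S g k) ≈S (v′ ∘S g k′) → k ≡ k′
    coset-disjoint k k′ v v′ (hv , dv≡0) (hv′ , dv′≡0) eq = begin
      k                                ≡⟨ sym (+F-identityˡ k) ⟩
      0F +F k                          ≡⟨ cong (_+F k) (sym dv≡0) ⟩
      defect (Φ v) +F k                ≡⟨ sym (defect-coset v k hv) ⟩
      defect (Φ (v ∘S g k))            ≡⟨ cong defect (Φ-cong eq) ⟩
      defect (Φ (v′ ∘S g k′))          ≡⟨ defect-coset v′ k′ hv′ ⟩
      defect (Φ v′) +F k′              ≡⟨ cong (_+F k′) dv′≡0 ⟩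
      0F +F k′                         ≡⟨ +F-identityˡ k′ ⟩
      k′                               ∎

proposition7p1 : (p : ℕ) .{{_ : NonZero p}} → Prime p → p ≢ 2 →
    (x₁ x₂ : Fp.F p) → x₂ ≢ Fp.0F p →
    (∃[ e ] ∃[ inv ] IsAbelianGroup _≡_ (Fp._⊕_ p) e inv)
    × (∀ u v → Fp.InN p u → Fp.InN p v →
         Fp.Φ p (Fp._∘S_ p u v) ≡ Fp._⊕_ p (Fp.Φ p u) (Fp.Φ p v))
    × (∀ (ab : Fp.F p × Fp.F p) → ∃[ u ] (Fp.InN p u × Fp.Φ p u ≡ ab))
    × (∀ u → Fp.InN p u → Fp.Φ p u ≡ (Fp.0F p , Fp.0F p) → Fp.InN12 p x₁ x₂ u)
    × (∀ w w' u → Fp.InN p w → Fp.InN p w' →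
         Fp._≈S_ p (Fp._∘S_ p w w') (Fp.tS p) →
         Fp._≈S_ p (Fp._∘S_ p w' w) (Fp.tS p) →
         Fp.InN12 p x₁ x₂ u →
         Fp.InN12 p x₁ x₂ (Fp._∘S_ p (Fp._∘S_ p w u) w'))
    × (∀ u → Fp.InN p u →
         ∃[ k ] ∃[ v ] (Fp.InN12 p x₁ x₂ v × Fp._≈S_ p (Fp._∘S_ p v (Fp.g p k)) u))
    × (∀ (k k' : Fp.F p) v v' → Fp.InN12 p x₁ x₂ v → Fp.InN12 p x₁ x₂ v' →
         Fp._≈S_ p (Fp._∘S_ p v (Fp.g p k)) (Fp._∘S_ p v' (Fp.g p k')) → k ≡ k')
proposition7p1 p _ _ x₁ x₂ _ =
    (⊕-zero , ⊕-inverse , ⊕-isAbelianGroup)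
  , Φ-hom
  , Φ-surjective
  , kernel⊆
  , conjugation-invariant
  , coset-cover
  , coset-disjoint
  where
  open Proof p
  open Cosets x₁ x₂
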